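{- Let $d\ge 2$ be an integer. For any graph $G$ of maximum degree at most $\Delta$ containing a vertex $v$ such that every vertex of $G$ is at distance at most $d-1$ from $v$, it holds that $OPT_d(G)=O(\Delta^{\lfloor d/2\rfloor})$.
   Context: Graphs are finite, simple, undirected; $d_G$ denotes shortest-path distance. A $d$-scattered set of $G$ is a set $K\subseteq V(G)$ with $d_G(u,w)\ge d$ for all distinct $u,w\in K$; $OPT_d(G)$ is its maximum size. -}

module Defs where

open import Data.Nat using (ℕ; zero; suc; _≤_)
open import Data.Bool using (Bool; true; false; T)
open import Data.Fin using (Fin)
open import Data.Fin.Subset using (Subset; _∈_)
open import Data.List using (length; filterᵇ; allFin)
open import Data.Product using (Σ; _×_; ∃)
open import Data.Unit using (⊤)
open import Relation.Binary.PropositionalEquality using (_≡_)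
open import Relation.Nullary using (¬_)

record Graph : Set where
  field
    n     : ℕ
    adj   : Fin n → Fin n → Bool
    sym   : ∀ u w → adj u w ≡ adj w u
    irrefl : ∀ u → adj u u ≡ false

open Graph public

data Walk (G : Graph) : Fin (n G) → Fin (n G) → ℕ → Set where
  here : ∀ u → Walk G u u zero
  step : ∀ {u v w k} → T (adj G u v) → Walk G v w k → Walk G u w (suc k)

DistLe : (G : Graph) → Fin (n G) → Fin (n G) → ℕ → Set
DistLe G u w k = Σ ℕ (λ l → l ≤ k × Walk G u w l)

-- d_G(u,w) ≥ d  (d ≥ 1): u and w are not at distance ≤ d - 1
-- (disconnected pairs have distance ∞ ≥ d).
DistGe : (G : Graph) → Fin (n G) → Fin (n G) → ℕ → Set
DistGe G u w zero    = ⊤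
DistGe G u w (suc k) = ¬ DistLe G u w k

degree : (G : Graph) → Fin (n G) → ℕ
degree G v = length (filterᵇ (adj G v) (allFin (n G)))

MaxDegreeAtMost : Graph → ℕ → Set
MaxDegreeAtMost G Δ = ∀ v → degree G v ≤ Δ

Scattered : (G : Graph) → ℕ → Subset (n G) → Set
Scattered G d K = ∀ u w → u ∈ K → w ∈ K → ¬ (u ≡ w) → DistGe G u w d

-- Let m = d - 1, s = ⌊m/2⌋ and r = ⌊d/2⌋, so that 2s ≤ m ≤ s + r.
-- Every vertex u of G lies within distance m of the centre v, so a
-- shortest walk from v to u passes through a vertex c(u) with
-- d(v, c(u)) ≤ r and d(c(u), u) ≤ s.  If c(x) = c(y) then
-- d(x, y) ≤ 2s ≤ d - 1, so on a d-scattered set K the map c is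
-- injective.  It takes values in the ball of radius r around v, and in a
-- graph of maximum degree Δ that ball has at most 1 + Δ + … + Δ^r
-- ≤ (r + 1)·Δ^r vertices.  Hence OPT_d(G) ≤ (⌊d/2⌋ + 1)·Δ^⌊d/2⌋.
module Submission where

open import Defs
open import Data.Nat using (ℕ; _≤_; _*_; _^_; _/_; _∸_)
open import Data.Fin using (Fin)
open import Data.Fin.Subset using (Subset; ∣_∣)
open import Data.Product using (Σ)

open import Data.Nat using (zero; suc; _+_; z≤n; s≤s; _≤?_)
open import Data.Nat.Properties using (+-suc; +-identityʳ; *-assoc; *-comm; ≤-refl; ≤-trans; ≤-pred; +-mono-≤; *-mono-≤; *-monoʳ-≤; *-monoˡ-≤; module ≤-Reasoning)
open import Data.Nat.DivMod using (m/n≡1+[m∸n]/n)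
open import Data.Fin using (zero; suc; _≟_)
open import Data.Fin.Properties using (0≢1+n) renaming (suc-injective to Fin-suc-injective)
open import Data.Fin.Subset using (inside; outside)
import Data.Fin.Subset as Subset
open import Data.Vec using ([]; _∷_; here; there)
open import Data.List using (List; []; _∷_; length; concatMap; filter; filterᵇ; allFin)
open import Data.List.Properties using (length-++; filter-notAll)
open import Data.List.Membership.Propositional using (_∈_)
open import Data.List.Membership.Propositional.Properties using (∈-filter⁺; ∈-concatMap⁺; ∈-allFin)
import Data.List.Relation.Unary.Any as Any
open import Data.Product using (_,_; _×_; proj₁; proj₂)
open import Data.Bool using (T; T?)
open import Data.Empty using (⊥-elim)
open import Relation.Nullary using (Dec; yes; no; ¬_)
open import Relation.Nullary.Decidable using (¬?)
open import Relation.Binary.PropositionalEquality using (_≡_; refl; subst; cong; module ≡-Reasoning) renaming (sym to ≡-sym)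

-- Every m splits as m ≤ s + ⌊(m+1)/2⌋ with 2s ≤ m (take s = ⌊m/2⌋).
-- For m = d - 1 this gives the two radii of the packing argument.
radiusSplit : ∀ m → Σ ℕ λ s → (s + s ≤ m) × (m ≤ s + suc m / 2)
radiusSplit zero = 0 , z≤n , z≤n
radiusSplit (suc zero) = 0 , z≤n , s≤s z≤n
radiusSplit (suc (suc j)) with radiusSplit j
... | s , 2s≤j , j≤s+r = suc s , 2s+2≤j+2 , j+2≤s+1+r
  where
  2s+2≤j+2 : suc s + suc s ≤ suc (suc j)
  2s+2≤j+2 rewrite +-suc s s = s≤s (s≤s 2s≤j)
  j+2≤s+1+r : suc (suc j) ≤ suc s + suc (suc (suc j)) / 2
  j+2≤s+1+r rewrite m/n≡1+[m∸n]/n {suc (suc (suc j))} {2} (s≤s (s≤s z≤n))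
                  | +-suc s (suc j / 2)
    = s≤s (s≤s j≤s+r)

geometricSum : ℕ → ℕ → ℕ
geometricSum Δ zero = 1
geometricSum Δ (suc k) = suc (Δ * geometricSum Δ k)

-- For Δ ≥ 1 each of the k + 1 terms is at most Δ^k.
geometricSum≤ : ∀ Δ k → 1 ≤ Δ → geometricSum Δ k ≤ suc k * Δ ^ k
geometricSum≤ Δ zero 1≤Δ = s≤s z≤n
geometricSum≤ Δ (suc k) 1≤Δ =
  +-mono-≤ (^-positive (suc k)) (subst (Δ * geometricSum Δ k ≤_) reassoc scaled)
  where
  ^-positive : ∀ j → 1 ≤ Δ ^ j
  ^-positive zero = s≤s z≤n
  ^-positive (suc j) = *-mono-≤ 1≤Δ (^-positive j)
  scaled : Δ * geometricSum Δ k ≤ Δ * (suc k * Δ ^ k)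
  scaled = *-monoʳ-≤ Δ (geometricSum≤ Δ k 1≤Δ)
  reassoc : Δ * (suc k * Δ ^ k) ≡ suc k * (Δ * Δ ^ k)
  reassoc = begin
    Δ * (suc k * Δ ^ k)   ≡⟨ ≡-sym (*-assoc Δ (suc k) _) ⟩
    (Δ * suc k) * Δ ^ k   ≡⟨ cong (_* Δ ^ k) (*-comm Δ (suc k)) ⟩
    (suc k * Δ) * Δ ^ k   ≡⟨ *-assoc (suc k) Δ _ ⟩
    suc k * (Δ * Δ ^ k)   ∎
    where open ≡-Reasoning

length-concatMap≤ : ∀ {A B : Set} (f : A → List B) c (xs : List A) →
  (∀ x → length (f x) ≤ c) → length (concatMap f xs) ≤ length xs * c
length-concatMap≤ f c [] _ = z≤n
length-concatMap≤ f c (x ∷ xs) bound rewrite length-++ (f x) {concatMap f xs} =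
  +-mono-≤ (bound x) (length-concatMap≤ f c xs bound)

module Distance (G : Graph) where

  Vertex : Set
  Vertex = Fin (n G)

  adj-sym : ∀ {u w} → T (adj G u w) → T (adj G w u)
  adj-sym {u} {w} = subst T (Defs.sym G u w)

  _++ʷ_ : ∀ {x y z a b} → Walk G x y a → Walk G y z b → Walk G x z (a + b)
  here _ ++ʷ q = q
  step e p ++ʷ q = step e (p ++ʷ q)

  reverseOnto : ∀ {x y w a b} → Walk G x y a → Walk G x w b → Walk G y w (a + b)
  reverseOnto (here _) acc = acc
  reverseOnto {b = b} (step {k = a} e p) acc =
    subst (Walk G _ _) (+-suc a b) (reverseOnto p (step (adj-sym e) acc))

  reverse : ∀ {x y a} → Walk G x y a → Walk G y x a
  reverse {x} {a = a} p = subst (Walk G _ _) (+-identityʳ a) (reverseOnto p (here x))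

  dist-mono : ∀ {u w k k′} → DistLe G u w k → k ≤ k′ → DistLe G u w k′
  dist-mono (l , l≤k , p) k≤k′ = l , ≤-trans l≤k k≤k′ , p

  dist-sym : ∀ {u w k} → DistLe G u w k → DistLe G w u k
  dist-sym (l , l≤k , p) = l , l≤k , reverse p

  dist-trans : ∀ {u v w j k} → DistLe G u v j → DistLe G v w k → DistLe G u w (j + k)
  dist-trans (a , a≤j , p) (b , b≤k , q) = a + b , +-mono-≤ a≤j b≤k , p ++ʷ q

  -- A walk of length at most s + r passes through a vertex within r of
  -- its start and within s of its end: walk r steps, or stop earlier if
  -- at most s steps remain.
  walk-split : ∀ s r {u w l} → Walk G u w l → l ≤ s + r →
    Σ Vertex λ z → DistLe G u z r × DistLe G z w s
  walk-split s r {u} (here _) _ = u , (0 , z≤n , here u) , (0 , z≤n , here u)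
  walk-split s r {u} {l = suc l} (step e p) l+1≤s+r with suc l ≤? s
  ... | yes l+1≤s = u , (0 , z≤n , here u) , (suc l , l+1≤s , step e p)
  walk-split s zero {l = suc l} (step e p) l+1≤s | no l+1≰s =
    ⊥-elim (l+1≰s (subst (suc l ≤_) (+-identityʳ s) l+1≤s))
  walk-split s (suc r) {l = suc l} (step e p) l+1≤s+r | no _
    with walk-split s r p (≤-pred (subst (suc l ≤_) (+-suc s r) l+1≤s+r))
  ... | z , (a , a≤r , p₁) , near-end = z , (suc a , s≤s a≤r , step e p₁) , near-end

  dist-split : ∀ s r {u w} → DistLe G u w (s + r) →
    Σ Vertex λ z → DistLe G u z r × DistLe G z w s
  dist-split s r (_ , l≤s+r , p) = walk-split s r p l≤s+r

  neighbours : Vertex → List Vertex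
  neighbours u = filterᵇ (adj G u) (allFin (n G))

  ball : ℕ → Vertex → List Vertex
  ball zero u = u ∷ []
  ball (suc k) u = u ∷ concatMap (ball k) (neighbours u)

  walk∈ball : ∀ {u w l} k → Walk G u w l → l ≤ k → w ∈ ball k u
  walk∈ball zero (here _) _ = Any.here refl
  walk∈ball (suc k) (here _) _ = Any.here refl
  walk∈ball (suc k) (step {v = v} e p) (s≤s l≤k) =
    Any.there (∈-concatMap⁺ (ball k)
      (Any.map (λ { refl → walk∈ball k p l≤k })
        (∈-filter⁺ (λ x → T? (adj G _ x)) (∈-allFin v) e)))

  dist∈ball : ∀ {u w k} → DistLe G u w k → w ∈ ball k u
  dist∈ball {k = k} (_ , l≤k , p) = walk∈ball k p l≤k

  ball-size : ∀ Δ → MaxDegreeAtMost G Δ → ∀ k u → length (ball k u) ≤ geometricSum Δ k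
  ball-size Δ maxDeg zero u = ≤-refl
  ball-size Δ maxDeg (suc k) u =
    s≤s (≤-trans (length-concatMap≤ (ball k) (geometricSum Δ k) (neighbours u)
                                     (ball-size Δ maxDeg k))
                 (*-monoˡ-≤ (geometricSum Δ k) (maxDeg u)))

-- Pigeonhole: a map that is injective on K and sends K into the list L
-- shows ∣ K ∣ ≤ length L.  Each element of K removes its image from L.
card≤length : ∀ {m N} (K : Subset m) (f : Fin m → Fin N) (L : List (Fin N)) →
  (∀ x → x Subset.∈ K → f x ∈ L) →
  (∀ x y → x Subset.∈ K → y Subset.∈ K → f x ≡ f y → x ≡ y) → ∣ K ∣ ≤ length L
card≤length [] f L _ _ = z≤n
card≤length (outside ∷ K) f L into inj =
  card≤length K (λ x → f (suc x)) L (λ x x∈K → into (suc x) (there x∈K))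
    (λ x y x∈K y∈K eq → Fin-suc-injective (inj _ _ (there x∈K) (there y∈K) eq))
card≤length {N = N} (inside ∷ K) f L into inj =
  ≤-trans (s≤s rest) (filter-notAll other? L (Any.map (λ eq neq → neq (≡-sym eq)) (into zero here)))
  where
  other? : (y : Fin N) → Dec (¬ (y ≡ f zero))
  other? y = ¬? (y ≟ f zero)
  rest : ∣ K ∣ ≤ length (filter other? L)
  rest = card≤length K (λ x → f (suc x)) (filter other? L)
    (λ x x∈K → ∈-filter⁺ other? (into (suc x) (there x∈K))
       (λ eq → 0≢1+n (≡-sym (inj (suc x) zero (there x∈K) here eq))))
    (λ x y x∈K y∈K eq → Fin-suc-injective (inj _ _ (there x∈K) (there y∈K) eq))

packing : ∀ {m s r} → s + s ≤ m → m ≤ s + r →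
  (G : Graph) (v : Fin (n G)) → ((u : Fin (n G)) → DistLe G v u m) →
  (K : Subset (n G)) → Scattered G (suc m) K →
  ∣ K ∣ ≤ length (Distance.ball G r v)
packing {m} {s} {r} 2s≤m m≤s+r G v radius K scattered =
  card≤length K waypoint (ball r v) (λ u _ → dist∈ball (near-centre u)) injective
  where
  open Distance G
  waypointOf : ∀ u → Σ Vertex λ z → DistLe G v z r × DistLe G z u s
  waypointOf u = dist-split s r (dist-mono (radius u) m≤s+r)
  waypoint : Vertex → Vertex
  waypoint u = proj₁ (waypointOf u)
  near-centre : ∀ u → DistLe G v (waypoint u) r
  near-centre u = proj₁ (proj₂ (waypointOf u))
  near-vertex : ∀ u → DistLe G (waypoint u) u s
  near-vertex u = proj₂ (proj₂ (waypointOf u))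
  close : ∀ x y → waypoint x ≡ waypoint y → DistLe G x y m
  close x y eq = dist-mono
    (dist-trans (dist-sym (near-vertex x)) (subst (λ z → DistLe G z y s) (≡-sym eq) (near-vertex y)))
    2s≤m
  injective : ∀ x y → x Subset.∈ K → y Subset.∈ K → waypoint x ≡ waypoint y → x ≡ y
  injective x y x∈K y∈K eq with x ≟ y
  ... | yes x≡y = x≡y
  ... | no x≢y = ⊥-elim (scattered x y x∈K y∈K x≢y (close x y eq))

lemma10 : (d : ℕ) → 2 ≤ d →
    Σ ℕ (λ C → (Δ : ℕ) → 1 ≤ Δ → (G : Graph) → MaxDegreeAtMost G Δ →
    (v : Fin (n G)) → ((u : Fin (n G)) → DistLe G v u (d ∸ 1)) →
    (K : Subset (n G)) → Scattered G d K → ∣ K ∣ ≤ C * Δ ^ (d / 2))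
lemma10 (suc (suc k)) (s≤s (s≤s z≤n)) = suc r , bound
  where
  r = suc (suc k) / 2
  bound : (Δ : ℕ) → 1 ≤ Δ → (G : Graph) → MaxDegreeAtMost G Δ →
    (v : Fin (n G)) → ((u : Fin (n G)) → DistLe G v u (suc k)) →
    (K : Subset (n G)) → Scattered G (suc (suc k)) K → ∣ K ∣ ≤ suc r * Δ ^ r
  bound Δ 1≤Δ G maxDeg v radius K scattered with radiusSplit (suc k)
  ... | s , 2s≤m , m≤s+r = begin
    ∣ K ∣                          ≤⟨ packing {suc k} {s} {r} 2s≤m m≤s+r G v radius K scattered ⟩
    length (Distance.ball G r v)   ≤⟨ Distance.ball-size G Δ maxDeg r v ⟩
    geometricSum Δ r               ≤⟨ geometricSum≤ Δ r 1≤Δ ⟩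
    suc r * Δ ^ r                  ∎
    where open ≤-Reasoning
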